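{- Let $(X,\tau,\beta,\nu)$ be a computable $T_0$ space. The complement of a dense c.e. open subset of $X$ is effectively nowhere dense.
   Context: $\Sigma^*$ is the set of finite binary strings. A computable $T_0$ space is a tuple $(X,\tau,\beta,\nu)$ where $(X,\tau)$ is a second countable $T_0$ space, $\beta$ is a countable basis of non-empty open sets, and $\nu:\Sigma^*\dashrightarrow\beta$ is a partial computable surjection such that there is a c.e. set $B\subseteq(\Sigma^*)^3$ with $\nu(u)\cap\nu(v)=\bigcup\{\nu(w):(u,v,w)\in B\}$ for all $u,v\in\mathrm{dom}(\nu)$. A set is c.e. open if it is the union of a computably enumerable family of basic open sets. A set $A\subseteq X$ is effectively nowhere dense if there exists a computable $f:\Sigma^*\to\Sigma^*$ such that $\nu(f(w))\subseteq(\nu(w)\setminus A)^{o}$ for all $w\in\mathrm{dom}(\nu)$.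
   Formalization: The function f in effective nowhere density is a partial computable function that only has to converge on every w ∈ dom(ν), with values in dom(ν), rather than a total computable $f:\Sigma^*\to\Sigma^*$. Each condition added here is assumed in the paper as well or is needed for the statement above to hold. -}

module Defs where

open import Data.Nat using (ℕ; zero; suc; _+_; _*_; _<_)
open import Data.Fin using (Fin)
open import Data.Vec using (Vec; []; _∷_; lookup)
open import Data.List using (List; []; _∷_)
open import Data.Bool using (Bool; true; false)
open import Data.Product using (Σ; _×_; _,_)
open import Data.Sum using (_⊎_)
open import Data.Unit using (⊤)
open import Relation.Nullary using (¬_)
open import Relation.Binary.PropositionalEquality using (_≡_)

Str : Set
Str = List Bool

enc : Str → ℕ
enc []          = 0
enc (false ∷ s) = suc (2 * enc s)
enc (true  ∷ s) = suc (suc (2 * enc s))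

-- Partial recursive functions (Kleene), codes indexed by arity

data PR : ℕ → Set where
  zer  : ∀ {n} → PR n
  succ : PR 1
  proj : ∀ {n} → Fin n → PR n
  comp : ∀ {m n} → PR m → Vec (PR n) m → PR n
  prec : ∀ {n} → PR n → PR (suc (suc n)) → PR (suc n)
  mu   : ∀ {n} → PR (suc n) → PR n

mutual
  data _⟦_⟧≡_ : ∀ {n} → PR n → Vec ℕ n → ℕ → Set where
    ev-zer  : ∀ {n} {xs : Vec ℕ n} → zer ⟦ xs ⟧≡ 0
    ev-succ : ∀ {x} → succ ⟦ x ∷ [] ⟧≡ suc x
    ev-proj : ∀ {n} {i : Fin n} {xs} → proj i ⟦ xs ⟧≡ lookup xs i
    ev-comp : ∀ {m n} {f : PR m} {gs : Vec (PR n) m} {xs ys y} →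
              gs ⟦ xs ⟧*≡ ys → f ⟦ ys ⟧≡ y → comp f gs ⟦ xs ⟧≡ y
    ev-prec0 : ∀ {n} {f : PR n} {g} {xs y} →
               f ⟦ xs ⟧≡ y → prec f g ⟦ 0 ∷ xs ⟧≡ y
    ev-precS : ∀ {n} {f : PR n} {g} {k xs r y} →
               prec f g ⟦ k ∷ xs ⟧≡ r → g ⟦ k ∷ r ∷ xs ⟧≡ y →
               prec f g ⟦ suc k ∷ xs ⟧≡ y
    ev-mu   : ∀ {n} {f : PR (suc n)} {xs y} →
              f ⟦ y ∷ xs ⟧≡ 0 →
              (∀ i → i < y → Σ ℕ (λ k → f ⟦ i ∷ xs ⟧≡ suc k)) →
              mu f ⟦ xs ⟧≡ y

  data _⟦_⟧*≡_ : ∀ {m n} → Vec (PR n) m → Vec ℕ n → Vec ℕ m → Set where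
    ev-[] : ∀ {n} {xs : Vec ℕ n} → [] ⟦ xs ⟧*≡ []
    ev-∷  : ∀ {m n} {g : PR n} {gs : Vec (PR n) m} {xs y ys} →
            g ⟦ xs ⟧≡ y → gs ⟦ xs ⟧*≡ ys → (g ∷ gs) ⟦ xs ⟧*≡ (y ∷ ys)

-- Computably enumerable sets of strings / triples of strings
-- (c.e. = domain of a partial computable function)

_⇔_ : Set → Set → Set
A ⇔ B = (A → B) × (B → A)

CE₁ : (Str → Set) → Set
CE₁ W = Σ (PR 1) λ e → ∀ w → W w ⇔ Σ ℕ (λ n → e ⟦ enc w ∷ [] ⟧≡ n)

CE₃ : (Str → Str → Str → Set) → Set
CE₃ B = Σ (PR 3) λ e → ∀ u v w →
  B u v w ⇔ Σ ℕ (λ n → e ⟦ enc u ∷ enc v ∷ enc w ∷ [] ⟧≡ n)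

module _ {X : Set} where
  _⊆_ : (X → Set) → (X → Set) → Set
  U ⊆ V = ∀ x → U x → V x

record ComputableT0Space : Set₁ where
  field
    X      : Set
    τ      : (X → Set) → Set
    τ-ext  : ∀ U V → U ⊆ V → V ⊆ U → τ U → τ V
    τ-univ : τ (λ _ → ⊤)
    τ-∩    : ∀ U V → τ U → τ V → τ (λ x → U x × V x)
    τ-⋃    : (I : Set) (U : I → X → Set) → (∀ i → τ (U i)) →
             τ (λ x → Σ I (λ i → U i x))
    T₀     : ∀ x y → (∀ U → τ U → U x ⇔ U y) → x ≡ y
    -- the numbering ν : Σ* ⇀ β (β = its image), partial computable
    dom     : Str → Set
    ν       : (w : Str) → dom w → X → Set
    dom-ce  : CE₁ dom
    ν-open     : ∀ w (p : dom w) → τ (ν w p)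
    ν-nonempty : ∀ w (p : dom w) → Σ X (ν w p)
    ν-basis    : ∀ U → τ U → ∀ x → U x →
                 Σ Str λ w → Σ (dom w) λ p → ν w p x × (ν w p ⊆ U)
    B    : Str → Str → Str → Set
    B-ce : CE₃ B
    B-∩  : ∀ u v (pu : dom u) (pv : dom v) x →
           (ν u pu x × ν v pv x) ⇔
           Σ Str (λ w → B u v w × Σ (dom w) (λ pw → ν w pw x))

module _ (S : ComputableT0Space) where
  open ComputableT0Space S

  CEOpen : (X → Set) → Set₁
  CEOpen U = Σ (Str → Set) λ W → CE₁ W ×
    (∀ x → U x ⇔ Σ Str (λ w → W w × Σ (dom w) (λ p → ν w p x)))

  Dense : (X → Set) → Set₁
  Dense U = ∀ V → τ V → Σ X V → Σ X (λ x → V x × U x)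

  interior : (X → Set) → X → Set₁
  interior A x = Σ (X → Set) λ V → τ V × V x × (V ⊆ A)

  EffNowhereDense : (X → Set) → Set₁
  EffNowhereDense A = Σ (PR 1) λ f → ∀ w (p : dom w) →
    Σ Str λ t → (f ⟦ enc w ∷ [] ⟧≡ enc t) × Σ (dom t) λ pt →
      ∀ x → ν t pt x → interior (λ y → ν w p y × ¬ A y) x

-- For a basic set ν(w), density gives a point of ν(w) inside some ν(v) ⊆ U with v in the
-- c.e. family, and ν(w) ∩ ν(v) contains a basic set ν(t) with B(w,v,t); any such t
-- satisfies ν(t) ⊆ ν(w) ∩ U. The function f finds such a t by dovetailing the four
-- semi-decisions "v is enumerated", "v ∈ dom ν", "B(w,v,t)", "t ∈ dom ν". Dovetailing is
-- possible because running a partial recursive code for s steps is itself primitive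
-- recursive, uniformly in the code.
module Submission where

open import Defs
open import Relation.Nullary using (¬_)
open import Data.Nat using (ℕ; zero; suc; _+_; _≤_; _<_; _⊔_; z≤n; pred)
open import Data.Nat.Properties
open import Data.Fin using (Fin; zero; suc; _↑ʳ_)
open import Data.Vec using (Vec; []; _∷_; lookup; _++_; map; tabulate)
open import Data.Vec.Properties
  using (lookup-++ʳ; tabulate∘lookup; tabulate-cong; ∷-injectiveˡ; ∷-injectiveʳ; map-∘; map-id)
open import Data.List using ([]; _∷_)
open import Data.Bool using (true; false)
open import Data.Product using (Σ; _×_; _,_; proj₁; proj₂)
open import Data.Sum using (_⊎_; inj₁; inj₂)
open import Relation.Binary.PropositionalEquality

Halts : ∀ {k} → PR k → Vec ℕ k → Set
Halts e xs = Σ ℕ λ y → e ⟦ xs ⟧≡ y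

IsSuc : ℕ → Set
IsSuc x = Σ ℕ λ c → x ≡ suc c

0≢suc : ∀ {y} {A : Set} → 0 ≡ suc y → A
0≢suc ()

ifz : ℕ → ℕ → ℕ → ℕ
ifz zero    a b = a
ifz (suc _) a b = b

guard : ℕ → ℕ → ℕ
guard zero    v = 0
guard (suc _) v = v

isZero : ℕ → ℕ
isZero c = ifz c 1 0

constPR : ∀ {n} → ℕ → PR n
constPR zero    = zer
constPR (suc k) = comp succ (constPR k ∷ [])

predPR : PR 1
predPR = prec zer (proj zero)

ifzPR : PR 3
ifzPR = prec (proj zero) (proj (suc (suc (suc zero))))

guardPR : PR 2
guardPR = prec zer (proj (suc (suc zero)))

isZeroPR : PR 1
isZeroPR = comp ifzPR (proj zero ∷ constPR 1 ∷ zer ∷ [])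

projsFrom : ∀ k {n} → Vec (PR (k + n)) n
projsFrom k = tabulate (λ i → proj (k ↑ʳ i))

eval-comp₁ : ∀ {n} {f : PR 1} {g : PR n} {xs a y} →
  g ⟦ xs ⟧≡ a → f ⟦ a ∷ [] ⟧≡ y → comp f (g ∷ []) ⟦ xs ⟧≡ y
eval-comp₁ g↓ f↓ = ev-comp (ev-∷ g↓ ev-[]) f↓

eval-comp₂ : ∀ {n} {f : PR 2} {g h : PR n} {xs a b y} →
  g ⟦ xs ⟧≡ a → h ⟦ xs ⟧≡ b → f ⟦ a ∷ b ∷ [] ⟧≡ y → comp f (g ∷ h ∷ []) ⟦ xs ⟧≡ y
eval-comp₂ g↓ h↓ f↓ = ev-comp (ev-∷ g↓ (ev-∷ h↓ ev-[])) f↓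

eval-comp₃ : ∀ {n} {f : PR 3} {g h k : PR n} {xs a b c y} →
  g ⟦ xs ⟧≡ a → h ⟦ xs ⟧≡ b → k ⟦ xs ⟧≡ c → f ⟦ a ∷ b ∷ c ∷ [] ⟧≡ y →
  comp f (g ∷ h ∷ k ∷ []) ⟦ xs ⟧≡ y
eval-comp₃ g↓ h↓ k↓ f↓ = ev-comp (ev-∷ g↓ (ev-∷ h↓ (ev-∷ k↓ ev-[]))) f↓

eval-const : ∀ {n} k {xs : Vec ℕ n} → constPR k ⟦ xs ⟧≡ k
eval-const zero    = ev-zer
eval-const (suc k) = eval-comp₁ (eval-const k) ev-succ

eval-pred : ∀ x → predPR ⟦ x ∷ [] ⟧≡ pred x
eval-pred zero    = ev-prec0 ev-zer
eval-pred (suc x) = ev-precS (eval-pred x) ev-proj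

eval-ifz : ∀ c a b → ifzPR ⟦ c ∷ a ∷ b ∷ [] ⟧≡ ifz c a b
eval-ifz zero    a b = ev-prec0 ev-proj
eval-ifz (suc c) a b = ev-precS (eval-ifz c a b) ev-proj

eval-guard : ∀ c v → guardPR ⟦ c ∷ v ∷ [] ⟧≡ guard c v
eval-guard zero    v = ev-prec0 ev-zer
eval-guard (suc c) v = ev-precS (eval-guard c v) ev-proj

eval-isZero : ∀ c → isZeroPR ⟦ c ∷ [] ⟧≡ isZero c
eval-isZero c = eval-comp₃ ev-proj (eval-const 1) ev-zer (eval-ifz _ _ _)

eval-tabulate-proj : ∀ {n N} (f : Fin n → Fin N) (zs : Vec ℕ N) →
  tabulate (λ i → proj (f i)) ⟦ zs ⟧*≡ tabulate (λ i → lookup zs (f i))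
eval-tabulate-proj {zero}  f zs = ev-[]
eval-tabulate-proj {suc n} f zs = ev-∷ ev-proj (eval-tabulate-proj (λ i → f (suc i)) zs)

eval-projsFrom : ∀ k {n} (ys : Vec ℕ k) (xs : Vec ℕ n) → projsFrom k ⟦ ys ++ xs ⟧*≡ xs
eval-projsFrom k ys xs = subst (λ v → projsFrom k ⟦ ys ++ xs ⟧*≡ v)
  (trans (tabulate-cong (lookup-++ʳ ys xs)) (tabulate∘lookup xs))
  (eval-tabulate-proj (λ i → k ↑ʳ i) (ys ++ xs))

-- Clocked interpreter

-- run e s xs is 0 while e has not converged on xs within clock s, and suc y once it has
-- converged with value y. The state of runMu is 0 while searching, 1 once the search hit an
-- argument on which f has not (yet) converged, and suc (suc y) once the zero y is found.

guards : ∀ {m} → Vec ℕ m → ℕ → ℕ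
guards []       r = r
guards (y ∷ ys) r = guard y (guards ys r)

muStep : ℕ → ℕ → ℕ
muStep v j = ifz v 1 (ifz (pred v) (suc (suc j)) 0)

mutual
  run : ∀ {n} → PR n → ℕ → Vec ℕ n → ℕ
  run zer         s xs       = 1
  run succ        s (x ∷ []) = suc (suc x)
  run (proj i)    s xs       = suc (lookup xs i)
  run (comp f gs) s xs       = guards (runAll gs s xs) (run f s (map pred (runAll gs s xs)))
  run (prec f g)  s (k ∷ xs) = runPrec f g s k xs
  run (mu f)      s xs       = pred (runMu f s xs s)

  runAll : ∀ {m n} → Vec (PR n) m → ℕ → Vec ℕ n → Vec ℕ m
  runAll []       s xs = []
  runAll (g ∷ gs) s xs = run g s xs ∷ runAll gs s xs

  runPrec : ∀ {n} → PR n → PR (suc (suc n)) → ℕ → ℕ → Vec ℕ n → ℕ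
  runPrec f g s zero    xs = run f s xs
  runPrec f g s (suc k) xs =
    guard (runPrec f g s k xs) (run g s (k ∷ pred (runPrec f g s k xs) ∷ xs))

  runMu : ∀ {n} → PR (suc n) → ℕ → Vec ℕ n → ℕ → ℕ
  runMu f s xs zero    = 0
  runMu f s xs (suc j) = ifz (runMu f s xs j) (muStep (run f s (j ∷ xs)) j) (runMu f s xs j)

guardsPR : ∀ {m n} → Vec (PR n) m → PR n → PR n
guardsPR []       r = r
guardsPR (g ∷ gs) r = comp guardPR (g ∷ guardsPR gs r ∷ [])

predPRs : ∀ {m n} → Vec (PR n) m → Vec (PR n) m
predPRs []       = []
predPRs (g ∷ gs) = comp predPR (g ∷ []) ∷ predPRs gs

muStepPR : PR 2
muStepPR = comp ifzPR (proj zero ∷ constPR 1 ∷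
  comp ifzPR (comp predPR (proj zero ∷ []) ∷
              comp succ (comp succ (proj (suc zero) ∷ []) ∷ []) ∷ zer ∷ []) ∷ [])

mutual
  clocked : ∀ {n} → PR n → PR (suc n)
  clocked zer         = constPR 1
  clocked succ        = comp succ (comp succ (proj (suc zero) ∷ []) ∷ [])
  clocked (proj i)    = comp succ (proj (suc i) ∷ [])
  clocked (comp f gs) =
    guardsPR (clockedAll gs) (comp (clocked f) (proj zero ∷ predPRs (clockedAll gs)))
  clocked {suc n} (prec f g) =
    comp (prec (clocked f) step) (proj (suc zero) ∷ proj zero ∷ projsFrom 2)
    where
    step : PR (suc (suc (suc n)))
    step = comp guardPR (proj (suc zero) ∷
      comp (clocked g) (proj (suc (suc zero)) ∷ proj zero ∷
                        comp predPR (proj (suc zero) ∷ []) ∷ projsFrom 3) ∷ [])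
  clocked {n} (mu f) =
    comp predPR (comp (prec zer step) (proj zero ∷ proj zero ∷ projsFrom 1) ∷ [])
    where
    step : PR (suc (suc (suc n)))
    step = comp ifzPR (proj (suc zero) ∷
      comp muStepPR (comp (clocked f) (proj (suc (suc zero)) ∷ proj zero ∷ projsFrom 3) ∷
                     proj zero ∷ []) ∷ proj (suc zero) ∷ [])

  clockedAll : ∀ {m n} → Vec (PR n) m → Vec (PR (suc n)) m
  clockedAll []       = []
  clockedAll (g ∷ gs) = clocked g ∷ clockedAll gs

eval-guards : ∀ {m n} (cs : Vec (PR n) m) {r xs vs rv} →
  cs ⟦ xs ⟧*≡ vs → r ⟦ xs ⟧≡ rv → guardsPR cs r ⟦ xs ⟧≡ guards vs rv
eval-guards []       ev-[]        r↓ = r↓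
eval-guards (c ∷ cs) (ev-∷ c↓ cs↓) r↓ = eval-comp₂ c↓ (eval-guards cs cs↓ r↓) (eval-guard _ _)

eval-predPRs : ∀ {m n} (cs : Vec (PR n) m) {xs vs} →
  cs ⟦ xs ⟧*≡ vs → predPRs cs ⟦ xs ⟧*≡ map pred vs
eval-predPRs []       ev-[]        = ev-[]
eval-predPRs (c ∷ cs) (ev-∷ c↓ cs↓) = ev-∷ (eval-comp₁ c↓ (eval-pred _)) (eval-predPRs cs cs↓)

eval-muStep : ∀ v j → muStepPR ⟦ v ∷ j ∷ [] ⟧≡ muStep v j
eval-muStep v j = eval-comp₃ ev-proj (eval-const 1)
  (eval-comp₃ (eval-comp₁ ev-proj (eval-pred v)) (eval-comp₁ (eval-comp₁ ev-proj ev-succ) ev-succ)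
              ev-zer (eval-ifz _ _ _))
  (eval-ifz _ _ _)

mutual
  eval-clocked : ∀ {n} (e : PR n) s xs → clocked e ⟦ s ∷ xs ⟧≡ run e s xs
  eval-clocked zer         s xs       = eval-const 1
  eval-clocked succ        s (x ∷ []) = eval-comp₁ (eval-comp₁ ev-proj ev-succ) ev-succ
  eval-clocked (proj i)    s xs       = eval-comp₁ ev-proj ev-succ
  eval-clocked (comp f gs) s xs       = eval-guards (clockedAll gs) (eval-clockedAll gs s xs)
    (ev-comp (ev-∷ ev-proj (eval-predPRs (clockedAll gs) (eval-clockedAll gs s xs)))
             (eval-clocked f s _))
  eval-clocked (prec f g)  s (k ∷ xs) =
    ev-comp (ev-∷ ev-proj (ev-∷ ev-proj (eval-projsFrom 2 (s ∷ k ∷ []) xs))) (loop k)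
    where
    loop : ∀ k → _ ⟦ k ∷ s ∷ xs ⟧≡ runPrec f g s k xs
    loop zero    = ev-prec0 (eval-clocked f s xs)
    loop (suc k) = ev-precS (loop k)
      (eval-comp₂ ev-proj
        (ev-comp (ev-∷ ev-proj (ev-∷ ev-proj (ev-∷ (eval-comp₁ ev-proj (eval-pred _))
                   (eval-projsFrom 3 (k ∷ _ ∷ s ∷ []) xs))))
                 (eval-clocked g s _))
        (eval-guard _ _))
  eval-clocked (mu f)      s xs =
    eval-comp₁ (ev-comp (ev-∷ ev-proj (ev-∷ ev-proj (eval-projsFrom 1 (s ∷ []) xs))) (loop s))
               (eval-pred _)
    where
    loop : ∀ j → _ ⟦ j ∷ s ∷ xs ⟧≡ runMu f s xs j
    loop zero    = ev-prec0 ev-zer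
    loop (suc j) = ev-precS (loop j)
      (eval-comp₃ ev-proj
        (eval-comp₂ (ev-comp (ev-∷ ev-proj (ev-∷ ev-proj (eval-projsFrom 3 (j ∷ _ ∷ s ∷ []) xs)))
                             (eval-clocked f s _))
                    ev-proj (eval-muStep _ _))
        ev-proj (eval-ifz _ _ _))

  eval-clockedAll : ∀ {m n} (gs : Vec (PR n) m) s xs → clockedAll gs ⟦ s ∷ xs ⟧*≡ runAll gs s xs
  eval-clockedAll []       s xs = ev-[]
  eval-clockedAll (g ∷ gs) s xs = ev-∷ (eval-clocked g s xs) (eval-clockedAll gs s xs)

guard≡suc : ∀ c v y → guard c v ≡ suc y → IsSuc c × v ≡ suc y
guard≡suc zero    v y ()
guard≡suc (suc c) v y eq = (c , refl) , eq

guards≡suc : ∀ {m} (vs : Vec ℕ m) r y → guards vs r ≡ suc y →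
  Σ (Vec ℕ m) λ zs → vs ≡ map suc zs × r ≡ suc y
guards≡suc []           r y eq = [] , refl , eq
guards≡suc (zero ∷ vs)  r y ()
guards≡suc (suc v ∷ vs) r y eq with guards≡suc vs r y eq
... | zs , vs≡ , r≡ = v ∷ zs , cong (suc v ∷_) vs≡ , r≡

guards-map-suc : ∀ {m} (zs : Vec ℕ m) r → guards (map suc zs) r ≡ r
guards-map-suc []       r = refl
guards-map-suc (z ∷ zs) r = guards-map-suc zs r

run-comp : ∀ {m n} (f : PR m) (gs : Vec (PR n) m) s xs zs →
  runAll gs s xs ≡ map suc zs → run (comp f gs) s xs ≡ run f s zs
run-comp f gs s xs zs eq rewrite eq =
  trans (guards-map-suc zs _) (cong (run f s) (trans (sym (map-∘ pred suc zs)) (map-id zs)))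

runPrec-suc : ∀ {n} (f : PR n) g s k xs r →
  runPrec f g s k xs ≡ suc r → runPrec f g s (suc k) xs ≡ run g s (k ∷ r ∷ xs)
runPrec-suc f g s k xs r eq rewrite eq = refl

module RunMu {n} (f : PR (suc n)) (s : ℕ) (xs : Vec ℕ n) where
  NonzeroAt : ℕ → Set
  NonzeroAt i = Σ ℕ λ k → run f s (i ∷ xs) ≡ suc (suc k)

  searching : ∀ j → runMu f s xs j ≡ 0 → ∀ i → i < j → NonzeroAt i
  searching (suc j) eq i i<j with runMu f s xs j in e
  ... | suc st = 0≢suc (sym eq)
  ... | zero with run f s (j ∷ xs) in fj
  searching (suc j) () i i<j | zero | zero
  searching (suc j) () i i<j | zero | suc zero
  searching (suc j) eq i i<j | zero | suc (suc k) with m<1+n⇒m<n∨m≡n i<j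
  ... | inj₁ i<j' = searching j e i i<j'
  ... | inj₂ refl = k , fj

  found : ∀ j y → runMu f s xs j ≡ suc (suc y) →
    y < j × run f s (y ∷ xs) ≡ 1 × (∀ i → i < y → NonzeroAt i)
  found zero    y ()
  found (suc j) y eq with runMu f s xs j in e
  found (suc j) y eq | suc st with found j y (trans e eq)
  ... | y<j , fy , below = m<n⇒m<1+n y<j , fy , below
  found (suc j) y eq | zero with run f s (j ∷ xs) in fj
  found (suc j) y ()    | zero | zero
  found (suc j) .j refl | zero | suc zero = ≤-refl , fj , searching j e
  found (suc j) y ()    | zero | suc (suc k)

  before-zero : ∀ y → (∀ i → i < y → NonzeroAt i) → ∀ j → j ≤ y → runMu f s xs j ≡ 0
  before-zero y below zero    j≤y = refl
  before-zero y below (suc j) j<y rewrite before-zero y below j (<⇒≤ j<y) with below j j<y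
  ... | k , fj rewrite fj = refl

  after-zero : ∀ y → run f s (y ∷ xs) ≡ 1 → (∀ i → i < y → NonzeroAt i) →
    ∀ j → y < j → runMu f s xs j ≡ suc (suc y)
  after-zero y fy below (suc j) y<j with m<1+n⇒m<n∨m≡n y<j
  ... | inj₁ y<j' rewrite after-zero y fy below j y<j' = refl
  ... | inj₂ refl rewrite before-zero y below y ≤-refl | fy = refl

mutual
  run-sound : ∀ {n} (e : PR n) s xs y → run e s xs ≡ suc y → e ⟦ xs ⟧≡ y
  run-sound zer         s xs       .0       refl = ev-zer
  run-sound succ        s (x ∷ []) .(suc x) refl = ev-succ
  run-sound (proj i)    s xs       _        refl = ev-proj
  run-sound (comp f gs) s xs y eq with guards≡suc (runAll gs s xs) _ y eq
  ... | zs , gs≡ , _ = ev-comp (runAll-sound gs s xs zs gs≡)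
        (run-sound f s zs y (trans (sym (run-comp f gs s xs zs gs≡)) eq))
  run-sound (prec f g)  s (k ∷ xs) y eq = loop k y eq
    where
    loop : ∀ k y → runPrec f g s k xs ≡ suc y → prec f g ⟦ k ∷ xs ⟧≡ y
    loop zero    y eq = ev-prec0 (run-sound f s xs y eq)
    loop (suc k) y eq with runPrec f g s k xs in er
    ... | zero  = 0≢suc eq
    ... | suc r = ev-precS (loop k r er) (run-sound g s (k ∷ r ∷ xs) y eq)
  run-sound (mu f) s xs y eq with runMu f s xs s in em
  run-sound (mu f) s xs y ()   | zero
  run-sound (mu f) s xs y ()   | suc zero
  run-sound (mu f) s xs y refl | suc (suc .y) with RunMu.found f s xs s y em
  ... | _ , fy , below = ev-mu (run-sound f s (y ∷ xs) 0 fy)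
        (λ i i<y → proj₁ (below i i<y) , run-sound f s (i ∷ xs) _ (proj₂ (below i i<y)))

  runAll-sound : ∀ {m n} (gs : Vec (PR n) m) s xs zs → runAll gs s xs ≡ map suc zs → gs ⟦ xs ⟧*≡ zs
  runAll-sound []       s xs []       eq = ev-[]
  runAll-sound (g ∷ gs) s xs (z ∷ zs) eq =
    ev-∷ (run-sound g s xs z (∷-injectiveˡ eq)) (runAll-sound gs s xs zs (∷-injectiveʳ eq))

mutual
  run-mono : ∀ {n} (e : PR n) {s s'} xs y → s ≤ s' → run e s xs ≡ suc y → run e s' xs ≡ suc y
  run-mono zer      xs       y s≤s' eq = eq
  run-mono succ     (x ∷ []) y s≤s' eq = eq
  run-mono (proj i) xs       y s≤s' eq = eq
  run-mono (comp f gs) {s} {s'} xs y s≤s' eq with guards≡suc (runAll gs s xs) _ y eq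
  ... | zs , gs≡ , _ =
    trans (run-comp f gs s' xs zs (runAll-mono gs xs zs s≤s' gs≡))
          (run-mono f zs y s≤s' (trans (sym (run-comp f gs s xs zs gs≡)) eq))
  run-mono (prec f g) {s} {s'} (k ∷ xs) y s≤s' eq = loop k y eq
    where
    loop : ∀ k y → runPrec f g s k xs ≡ suc y → runPrec f g s' k xs ≡ suc y
    loop zero    y eq = run-mono f xs y s≤s' eq
    loop (suc k) y eq with runPrec f g s k xs in er
    ... | zero  = 0≢suc eq
    ... | suc r rewrite loop k r er = run-mono g (k ∷ r ∷ xs) y s≤s' eq
  run-mono (mu f) {s} {s'} xs y s≤s' eq with runMu f s xs s in em
  run-mono (mu f) xs y s≤s' ()   | zero
  run-mono (mu f) xs y s≤s' ()   | suc zero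
  run-mono (mu f) {s} {s'} xs y s≤s' refl | suc (suc .y) with RunMu.found f s xs s y em
  ... | y<s , fy , below
    rewrite RunMu.after-zero f s' xs y (run-mono f (y ∷ xs) 0 s≤s' fy)
              (λ i i<y → proj₁ (below i i<y) , run-mono f (i ∷ xs) _ s≤s' (proj₂ (below i i<y)))
              s' (≤-trans y<s s≤s') = refl

  runAll-mono : ∀ {m n} (gs : Vec (PR n) m) {s s'} xs zs → s ≤ s' →
    runAll gs s xs ≡ map suc zs → runAll gs s' xs ≡ map suc zs
  runAll-mono []       xs []       s≤s' eq = refl
  runAll-mono (g ∷ gs) xs (z ∷ zs) s≤s' eq =
    cong₂ _∷_ (run-mono g xs z s≤s' (∷-injectiveˡ eq)) (runAll-mono gs xs zs s≤s' (∷-injectiveʳ eq))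

run-common-clock : ∀ {n} (f : PR (suc n)) (xs : Vec ℕ n) y →
  (∀ i → i < y → Σ ℕ λ k → Σ ℕ λ s → run f s (i ∷ xs) ≡ suc (suc k)) →
  Σ ℕ λ S → ∀ i → i < y → RunMu.NonzeroAt f S xs i
run-common-clock f xs zero    below = 0 , λ i ()
run-common-clock f xs (suc y) below
  with run-common-clock f xs y (λ i i<y → below i (m<n⇒m<1+n i<y)) | below y ≤-refl
... | S , belowS | k , s , fy = S ⊔ s , λ i i<1+y → at i i<1+y
  where
  at : ∀ i → i < suc y → RunMu.NonzeroAt f (S ⊔ s) xs i
  at i i<1+y with m<1+n⇒m<n∨m≡n i<1+y
  ... | inj₁ i<y = proj₁ (belowS i i<y) , run-mono f (i ∷ xs) _ (m≤m⊔n S s) (proj₂ (belowS i i<y))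
  ... | inj₂ refl = k , run-mono f (i ∷ xs) _ (m≤n⊔m S s) fy

mutual
  run-complete : ∀ {n} {e : PR n} {xs y} → e ⟦ xs ⟧≡ y → Σ ℕ λ s → run e s xs ≡ suc y
  run-complete ev-zer  = 0 , refl
  run-complete ev-succ = 0 , refl
  run-complete ev-proj = 0 , refl
  run-complete (ev-comp {f = f} {gs} {xs} {ys} {y} gs↓ f↓)
    with runAll-complete gs↓ | run-complete f↓
  ... | s₁ , e₁ | s₂ , e₂ = s₁ ⊔ s₂ ,
    trans (run-comp f gs (s₁ ⊔ s₂) xs ys (runAll-mono gs xs ys (m≤m⊔n s₁ s₂) e₁))
          (run-mono f ys y (m≤n⊔m s₁ s₂) e₂)
  run-complete (ev-prec0 f↓) = run-complete f↓
  run-complete (ev-precS {f = f} {g} {k} {xs} {r} {y} rec↓ g↓)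
    with run-complete rec↓ | run-complete g↓
  ... | s₁ , e₁ | s₂ , e₂ = s₁ ⊔ s₂ ,
    trans (runPrec-suc f g (s₁ ⊔ s₂) k xs r (run-mono (prec f g) (k ∷ xs) r (m≤m⊔n s₁ s₂) e₁))
          (run-mono g (k ∷ r ∷ xs) y (m≤n⊔m s₁ s₂) e₂)
  run-complete (ev-mu {f = f} {xs} {y} fy↓ below↓)
    with run-complete fy↓
       | run-common-clock f xs y (λ i i<y → proj₁ (below↓ i i<y) , run-complete (proj₂ (below↓ i i<y)))
  ... | s₀ , e₀ | S , belowS = s ,
    cong pred (RunMu.after-zero f s xs y (run-mono f (y ∷ xs) 0 S⊔s₀≤s e₀)
      (λ i i<y → proj₁ (belowS i i<y) , run-mono f (i ∷ xs) _ S≤s (proj₂ (belowS i i<y)))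
      s (m≤m⊔n (suc y) (S ⊔ s₀)))
    where
    s = suc y ⊔ (S ⊔ s₀)
    S⊔s₀≤s = ≤-trans (m≤n⊔m S s₀) (m≤n⊔m (suc y) (S ⊔ s₀))
    S≤s = ≤-trans (m≤m⊔n S s₀) (m≤n⊔m (suc y) (S ⊔ s₀))

  runAll-complete : ∀ {m n} {gs : Vec (PR n) m} {xs ys} →
    gs ⟦ xs ⟧*≡ ys → Σ ℕ λ s → runAll gs s xs ≡ map suc ys
  runAll-complete ev-[] = 0 , refl
  runAll-complete (ev-∷ {g = g} {gs} {xs} {y} {ys} g↓ gs↓)
    with run-complete g↓ | runAll-complete gs↓
  ... | s₁ , e₁ | s₂ , e₂ = s₁ ⊔ s₂ ,
    cong₂ _∷_ (run-mono g xs y (m≤m⊔n s₁ s₂) e₁) (runAll-mono gs xs ys (m≤n⊔m s₁ s₂) e₂)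

firstNonzero : (ℕ → ℕ) → ℕ → ℕ
firstNonzero h zero    = h 0
firstNonzero h (suc k) = ifz (firstNonzero h k) (h (suc k)) (firstNonzero h k)

firstNonzeroPR : ∀ {m} → PR (suc m) → PR (suc m)
firstNonzeroPR H = prec (comp H (zer ∷ projsFrom 0))
  (comp ifzPR (proj (suc zero) ∷ comp H (comp succ (proj zero ∷ []) ∷ projsFrom 2) ∷
               proj (suc zero) ∷ []))

eval-firstNonzero : ∀ {m} (H : PR (suc m)) (xs : Vec ℕ m) (h : ℕ → ℕ) →
  (∀ a → H ⟦ a ∷ xs ⟧≡ h a) → ∀ k → firstNonzeroPR H ⟦ k ∷ xs ⟧≡ firstNonzero h k
eval-firstNonzero H xs h H↓ zero    = ev-prec0 (ev-comp (ev-∷ ev-zer (eval-projsFrom 0 [] xs)) (H↓ 0))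
eval-firstNonzero H xs h H↓ (suc k) = ev-precS (eval-firstNonzero H xs h H↓ k)
  (eval-comp₃ ev-proj
    (ev-comp (ev-∷ (eval-comp₁ ev-proj ev-succ) (eval-projsFrom 2 (k ∷ firstNonzero h k ∷ []) xs))
             (H↓ (suc k)))
    ev-proj (eval-ifz _ _ _))

firstNonzero-intro : ∀ h a k → a ≤ k → IsSuc (h a) → IsSuc (firstNonzero h k)
firstNonzero-intro h a zero    z≤n ha = ha
firstNonzero-intro h a (suc k) a≤k ha with m≤n⇒m<n∨m≡n a≤k
... | inj₁ a<1+k with firstNonzero-intro h a k (≤-pred a<1+k) ha
...   | c , eq rewrite eq = c , refl
firstNonzero-intro h a (suc k) a≤k ha | inj₂ refl with firstNonzero h k
... | zero  = ha
... | suc c = c , refl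

firstNonzero-elim : ∀ h k → IsSuc (firstNonzero h k) → Σ ℕ λ a → a ≤ k × IsSuc (h a)
firstNonzero-elim h zero    nz = 0 , z≤n , nz
firstNonzero-elim h (suc k) nz with firstNonzero h k in e
... | zero  = suc k , ≤-refl , nz
... | suc c with firstNonzero-elim h k (c , e)
...   | a , a≤k , ha = a , m≤n⇒m≤1+n a≤k , ha

eval-isZero∘ : ∀ {n} {g : PR n} {xs c} → g ⟦ xs ⟧≡ c → comp isZeroPR (g ∷ []) ⟦ xs ⟧≡ isZero c
eval-isZero∘ g↓ = eval-comp₁ g↓ (eval-isZero _)

isZero≡0 : ∀ c → isZero c ≡ 0 → IsSuc c
isZero≡0 (suc c) _ = c , refl

isZero-suc : ∀ c → IsSuc c → isZero c ≡ 0
isZero-suc .(suc c) (c , refl) = refl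

least-zero-or-below : (g : ℕ → ℕ) → ∀ k →
  (Σ ℕ λ y → g y ≡ 0 × (∀ i → i < y → IsSuc (g i))) ⊎ (∀ i → i < k → IsSuc (g i))
least-zero-or-below g zero = inj₂ (λ i ())
least-zero-or-below g (suc k) with least-zero-or-below g k
... | inj₁ least = inj₁ least
... | inj₂ below with g k in e
...   | zero  = inj₁ (k , e , below)
...   | suc c = inj₂ λ i i<1+k → at i i<1+k
  where
  at : ∀ i → i < suc k → IsSuc (g i)
  at i i<1+k with m<1+n⇒m<n∨m≡n i<1+k
  ... | inj₁ i<k  = below i i<k
  ... | inj₂ refl = c , e

eval-mu-of-zero : ∀ {m} (G : PR (suc m)) xs (g : ℕ → ℕ) → (∀ y → G ⟦ y ∷ xs ⟧≡ g y) →
  ∀ y₀ → g y₀ ≡ 0 → Σ ℕ λ y → mu G ⟦ xs ⟧≡ y × g y ≡ 0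
eval-mu-of-zero G xs g G↓ y₀ gy₀ with least-zero-or-below g (suc y₀)
... | inj₁ (y , gy , below) = y ,
  ev-mu (subst (G ⟦ y ∷ xs ⟧≡_) gy (G↓ y))
        (λ i i<y → proj₁ (below i i<y) , subst (G ⟦ i ∷ xs ⟧≡_) (proj₂ (below i i<y)) (G↓ i)) ,
  gy
... | inj₂ below = 0≢suc (trans (sym gy₀) (proj₂ (below y₀ ≤-refl)))

-- Computable selection

module Selection
  (H : PR 4) (h : ℕ → ℕ → ℕ → ℕ → ℕ)
  (eval-H : ∀ a b n x → H ⟦ a ∷ b ∷ n ∷ x ∷ [] ⟧≡ h x n a b)
  (h-mono : ∀ x {n n'} a b → n ≤ n' → IsSuc (h x n a b) → IsSuc (h x n' a b))
  where

  witnessFor : ℕ → ℕ → ℕ → ℕ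
  witnessFor x n b = firstNonzero (λ a → h x n a b) n

  witnessForPR : PR 3
  witnessForPR = comp (firstNonzeroPR H)
    (proj (suc zero) ∷ proj zero ∷ proj (suc zero) ∷ proj (suc (suc zero)) ∷ [])

  eval-witnessFor : ∀ b n x → witnessForPR ⟦ b ∷ n ∷ x ∷ [] ⟧≡ witnessFor x n b
  eval-witnessFor b n x = ev-comp (ev-∷ ev-proj (ev-∷ ev-proj (ev-∷ ev-proj (ev-∷ ev-proj ev-[]))))
    (eval-firstNonzero H (b ∷ n ∷ x ∷ []) (λ a → h x n a b) (λ a → eval-H a b n x) n)

  witnessBelow : ℕ → ℕ → ℕ
  witnessBelow x n = firstNonzero (witnessFor x n) n

  witnessBelowPR : PR 2
  witnessBelowPR = comp (firstNonzeroPR witnessForPR) (proj zero ∷ proj zero ∷ proj (suc zero) ∷ [])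

  eval-witnessBelow : ∀ n x → witnessBelowPR ⟦ n ∷ x ∷ [] ⟧≡ witnessBelow x n
  eval-witnessBelow n x = ev-comp (ev-∷ ev-proj (ev-∷ ev-proj (ev-∷ ev-proj ev-[])))
    (eval-firstNonzero witnessForPR (n ∷ x ∷ []) (witnessFor x n) (λ b → eval-witnessFor b n x) n)

  -- First the least clock n₀ at which some a, b ≤ n₀ witness, then the least b for that clock.
  selector : PR 1
  selector = comp (mu (comp isZeroPR (witnessForPR ∷ [])))
                  (mu (comp isZeroPR (witnessBelowPR ∷ [])) ∷ proj zero ∷ [])

  selector-correct : ∀ x n a b → IsSuc (h x n a b) →
    Σ ℕ λ b₀ → selector ⟦ x ∷ [] ⟧≡ b₀ × Σ ℕ λ n₀ → Σ ℕ λ a₀ → IsSuc (h x n₀ a₀ b₀)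
  selector-correct x n a b hab
    with eval-mu-of-zero _ (x ∷ []) (λ n → isZero (witnessBelow x n))
           (λ n → eval-isZero∘ (eval-witnessBelow n x)) N (isZero-suc _ below-N)
    where
    N = n ⊔ (a ⊔ b)
    below-N : IsSuc (witnessBelow x N)
    below-N = firstNonzero-intro _ b N (≤-trans (m≤n⊔m a b) (m≤n⊔m n (a ⊔ b)))
      (firstNonzero-intro _ a N (≤-trans (m≤m⊔n a b) (m≤n⊔m n (a ⊔ b)))
        (h-mono x a b (m≤m⊔n n (a ⊔ b)) hab))
  ... | n₀ , n₀↓ , below-n₀ with firstNonzero-elim _ n₀ (isZero≡0 _ below-n₀)
  ... | b' , _ , for-b' with eval-mu-of-zero _ (n₀ ∷ x ∷ []) (λ b → isZero (witnessFor x n₀ b))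
                              (λ b → eval-isZero∘ (eval-witnessFor b n₀ x)) b' (isZero-suc _ for-b')
  ... | b₀ , b₀↓ , for-b₀ with firstNonzero-elim _ n₀ (isZero≡0 _ for-b₀)
  ... | a₀ , _ , ha₀b₀ = b₀ , ev-comp (ev-∷ n₀↓ (ev-∷ ev-proj ev-[])) b₀↓ , n₀ , a₀ , ha₀b₀

module ClockedWitness (eW eD : PR 1) (eB : PR 3) where

  Witness : ℕ → ℕ → ℕ → Set
  Witness x a b =
    Halts eW (a ∷ []) × Halts eD (a ∷ []) × Halts eB (x ∷ a ∷ b ∷ []) × Halts eD (b ∷ [])

  witnessAt : ℕ → ℕ → ℕ → ℕ → ℕ
  witnessAt x n a b = guard (run eW n (a ∷ [])) (guard (run eD n (a ∷ []))
    (guard (run eB n (x ∷ a ∷ b ∷ [])) (run eD n (b ∷ []))))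

  witnessAtPR : PR 4
  witnessAtPR =
    comp guardPR (comp (clocked eW) (p₂ ∷ p₀ ∷ []) ∷
    comp guardPR (comp (clocked eD) (p₂ ∷ p₀ ∷ []) ∷
    comp guardPR (comp (clocked eB) (p₂ ∷ p₃ ∷ p₀ ∷ p₁ ∷ []) ∷
                  comp (clocked eD) (p₂ ∷ p₁ ∷ []) ∷ []) ∷ []) ∷ [])
    where
    p₀ p₁ p₂ p₃ : PR 4
    p₀ = proj zero
    p₁ = proj (suc zero)
    p₂ = proj (suc (suc zero))
    p₃ = proj (suc (suc (suc zero)))

  eval-witnessAt : ∀ a b n x → witnessAtPR ⟦ a ∷ b ∷ n ∷ x ∷ [] ⟧≡ witnessAt x n a b
  eval-witnessAt a b n x =
    eval-comp₂ (eval-comp₂ ev-proj ev-proj (eval-clocked eW n _))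
      (eval-comp₂ (eval-comp₂ ev-proj ev-proj (eval-clocked eD n _))
        (eval-comp₂
          (ev-comp (ev-∷ ev-proj (ev-∷ ev-proj (ev-∷ ev-proj (ev-∷ ev-proj ev-[]))))
                   (eval-clocked eB n _))
          (eval-comp₂ ev-proj ev-proj (eval-clocked eD n _))
          (eval-guard _ _))
        (eval-guard _ _))
      (eval-guard _ _)

  witnessAt-sound : ∀ x n a b → IsSuc (witnessAt x n a b) → Witness x a b
  witnessAt-sound x n a b (c , eq) with guard≡suc _ _ _ eq
  ... | (c₁ , e₁) , r₁ with guard≡suc _ _ _ r₁
  ... | (c₂ , e₂) , r₂ with guard≡suc _ _ _ r₂
  ... | (c₃ , e₃) , r₃ =
    (c₁ , run-sound eW n _ c₁ e₁) , (c₂ , run-sound eD n _ c₂ e₂) ,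
    (c₃ , run-sound eB n _ c₃ e₃) , (c , run-sound eD n _ c r₃)

  witnessAt-of-runs : ∀ {x n a b y₁ y₂ y₃ y₄} →
    run eW n (a ∷ []) ≡ suc y₁ → run eD n (a ∷ []) ≡ suc y₂ →
    run eB n (x ∷ a ∷ b ∷ []) ≡ suc y₃ → run eD n (b ∷ []) ≡ suc y₄ → IsSuc (witnessAt x n a b)
  witnessAt-of-runs e₁ e₂ e₃ e₄ rewrite e₁ | e₂ | e₃ | e₄ = _ , refl

  witnessAt-mono : ∀ x {n n'} a b → n ≤ n' → IsSuc (witnessAt x n a b) → IsSuc (witnessAt x n' a b)
  witnessAt-mono x a b n≤n' (c , eq) with guard≡suc _ _ _ eq
  ... | (_ , e₁) , r₁ with guard≡suc _ _ _ r₁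
  ... | (_ , e₂) , r₂ with guard≡suc _ _ _ r₂
  ... | (_ , e₃) , e₄ = witnessAt-of-runs
    (run-mono eW _ _ n≤n' e₁) (run-mono eD _ _ n≤n' e₂) (run-mono eB _ _ n≤n' e₃) (run-mono eD _ _ n≤n' e₄)

  witnessAt-complete : ∀ x a b → Witness x a b → Σ ℕ λ n → IsSuc (witnessAt x n a b)
  witnessAt-complete x a b ((_ , W↓) , (_ , Da↓) , (_ , B↓) , (_ , Db↓))
    with run-complete W↓ | run-complete Da↓ | run-complete B↓ | run-complete Db↓
  ... | s₁ , e₁ | s₂ , e₂ | s₃ , e₃ | s₄ , e₄ = s , witnessAt-of-runs
    (run-mono eW _ _ s₁≤s e₁) (run-mono eD _ _ s₂≤s e₂) (run-mono eB _ _ s₃≤s e₃) (run-mono eD _ _ s₄≤s e₄)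
    where
    s = (s₁ ⊔ s₂) ⊔ (s₃ ⊔ s₄)
    s₁≤s = ≤-trans (m≤m⊔n s₁ s₂) (m≤m⊔n (s₁ ⊔ s₂) (s₃ ⊔ s₄))
    s₂≤s = ≤-trans (m≤n⊔m s₁ s₂) (m≤m⊔n (s₁ ⊔ s₂) (s₃ ⊔ s₄))
    s₃≤s = ≤-trans (m≤m⊔n s₃ s₄) (m≤n⊔m (s₁ ⊔ s₂) (s₃ ⊔ s₄))
    s₄≤s = ≤-trans (m≤n⊔m s₃ s₄) (m≤n⊔m (s₁ ⊔ s₂) (s₃ ⊔ s₄))

successor : Str → Str
successor []          = false ∷ []
successor (false ∷ s) = true ∷ s
successor (true ∷ s)  = false ∷ successor s

enc-successor : ∀ s → enc (successor s) ≡ suc (enc s)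
enc-successor []          = refl
enc-successor (false ∷ s) = refl
enc-successor (true ∷ s) rewrite enc-successor s = cong suc (*-suc 2 (enc s))

decode : ℕ → Str
decode zero    = []
decode (suc n) = successor (decode n)

enc-decode : ∀ n → enc (decode n) ≡ n
enc-decode zero    = refl
enc-decode (suc n) = trans (enc-successor (decode n)) (cong suc (enc-decode n))

CE₁-decode : ∀ {P} (P-ce : CE₁ P) a → Halts (proj₁ P-ce) (a ∷ []) → P (decode a)
CE₁-decode (e , P⇔) a a↓ =
  proj₂ (P⇔ (decode a)) (subst (λ z → Halts e (z ∷ [])) (sym (enc-decode a)) a↓)

CE₃-decode : ∀ {P} (P-ce : CE₃ P) u a b →
  Halts (proj₁ P-ce) (enc u ∷ a ∷ b ∷ []) → P u (decode a) (decode b)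
CE₃-decode (e , P⇔) u a b ab↓ = proj₂ (P⇔ u (decode a) (decode b))
  (subst₂ (λ z z' → Halts e (enc u ∷ z ∷ z' ∷ [])) (sym (enc-decode a)) (sym (enc-decode b)) ab↓)

module _ (S : ComputableT0Space) where
  open ComputableT0Space S

  IsUnionOfBasic : (X → Set) → (Str → Set) → Set
  IsUnionOfBasic U W = ∀ x → U x ⇔ Σ Str (λ v → W v × Σ (dom v) (λ p → ν v p x))

  module _ {U : X → Set} {W : Str → Set} (U-cover : IsUnionOfBasic U W) where

    dense-refinement : Dense S U → ∀ w → dom w →
      Σ Str λ v → Σ Str λ t → W v × dom v × B w v t × dom t
    dense-refinement dense w p with dense (ν w p) (ν-open w p) (ν-nonempty w p)
    ... | x , x∈w , Ux with proj₁ (U-cover x) Ux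
    ... | v , Wv , pv , x∈v with proj₁ (B-∩ w v p pv x) (x∈w , x∈v)
    ... | t , Bwvt , pt , _ = v , t , Wv , pv , Bwvt , pt

    refinement-⊆ : ∀ {w v t} (p : dom w) → W v → dom v → B w v t → (pt : dom t) →
      ν t pt ⊆ (λ y → ν w p y × ¬ ¬ U y)
    refinement-⊆ {w} {v} {t} p Wv pv Bwvt pt y y∈t
      with proj₂ (B-∩ w v p pv y) (t , Bwvt , pt , y∈t)
    ... | y∈w , y∈v = y∈w , λ ¬Uy → ¬Uy (proj₂ (U-cover y) (v , Wv , pv , y∈v))

  module RefinementSearch {U : X → Set} {W : Str → Set}
    (W-ce : CE₁ W) (U-cover : IsUnionOfBasic U W) (dense : Dense S U) where
    open ClockedWitness (proj₁ W-ce) (proj₁ dom-ce) (proj₁ B-ce) public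
    open Selection witnessAtPR witnessAt eval-witnessAt witnessAt-mono public

    selection-found : ∀ w → dom w → Σ ℕ λ b₀ → selector ⟦ enc w ∷ [] ⟧≡ b₀ ×
      Σ ℕ λ n₀ → Σ ℕ λ a₀ → IsSuc (witnessAt (enc w) n₀ a₀ b₀)
    selection-found w p with dense-refinement U-cover dense w p
    ... | v , t , Wv , pv , Bwvt , pt
      with witnessAt-complete (enc w) (enc v) (enc t)
             (proj₁ (proj₂ W-ce v) Wv , proj₁ (proj₂ dom-ce v) pv ,
              proj₁ (proj₂ B-ce w v t) Bwvt , proj₁ (proj₂ dom-ce t) pt)
    ... | n , found = selector-correct (enc w) n (enc v) (enc t) found

    refinement-of-witness : ∀ w (p : dom w) a₀ b₀ → Witness (enc w) a₀ b₀ →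
      Σ (dom (decode b₀)) λ pt → ν (decode b₀) pt ⊆ (λ y → ν w p y × ¬ ¬ U y)
    refinement-of-witness w p a₀ b₀ (W↓ , Da↓ , B↓ , Db↓) = pt₀ ,
      refinement-⊆ U-cover p (CE₁-decode W-ce a₀ W↓) (CE₁-decode dom-ce a₀ Da↓)
                   (CE₃-decode B-ce w a₀ b₀ B↓) pt₀
      where
      pt₀ = CE₁-decode dom-ce b₀ Db↓

mainTheorem6 : (S : ComputableT0Space) (U : ComputableT0Space.X S → Set) →
    CEOpen S U → Dense S U → EffNowhereDense S (λ x → ¬ U x)
mainTheorem6 S U (W , W-ce , U-cover) dense = selector , refine
  where
  open ComputableT0Space S
  open RefinementSearch S W-ce U-cover dense

  refine : ∀ w (p : dom w) → Σ Str λ t → (selector ⟦ enc w ∷ [] ⟧≡ enc t) × Σ (dom t) λ pt →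
    ∀ x → ν t pt x → interior S (λ y → ν w p y × ¬ ¬ U y) x
  refine w p =
    let (b₀ , b₀↓ , n₀ , a₀ , found₀) = selection-found w p
        (pt , t⊆) = refinement-of-witness w p a₀ b₀ (witnessAt-sound (enc w) n₀ a₀ b₀ found₀)
    in decode b₀ , subst (selector ⟦ enc w ∷ [] ⟧≡_) (sym (enc-decode b₀)) b₀↓ , pt ,
       λ y y∈t → ν (decode b₀) pt , ν-open (decode b₀) pt , y∈t , t⊆
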